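{- Let $G=(V,E)$ be a graph, $T$ any $4$-Steiner root of $G$, $X$ a clique-intersection of $G$ and $S\subsetneq X$ a minimal separator of $G$. If $T\langle S\rangle$ is a non-edge star, then there exists a node $c\in N_T[\mathcal{C}(T\langle X\rangle)]$ such that $\mathrm{Real}(N_T[c])=S$.
   Context: A $4$-Steiner root of $G$ is a tree $T$ with $V\subseteq V(T)$ such that for distinct $u,v\in V$, $uv\in E$ iff $\mathrm{dist}_T(u,v)\le4$; $\mathrm{Real}(Y)=Y\cap V$. $T\langle X\rangle$ is the smallest subtree of $T$ containing $X$, $\mathcal{C}(T')$ the center of a tree $T'$; $N_T[c]$ is the closed neighbourhood of $c$ in $T$ and $N_T[Z]$ the union of closed neighbourhoods of nodes of $Z$. A non-edge star is a tree of diameter exactly $2$. A clique-intersection is a nonempty intersection of one or more maximal cliques of $G$. -}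

module Defs where

open import Data.Nat using (ℕ; zero; suc; _≤_)
open import Data.Fin using (Fin)
open import Data.Fin.Subset using (Subset; _∈_; _∉_; _⊆_; _⊂_; Nonempty; ⋂; ∁; ⊤)
open import Data.List using (List; []; _∷_; length; _∷ʳ_)
open import Data.List.Relation.Unary.Linked using (Linked)
open import Data.List.Relation.Unary.All using (All)
open import Data.List.Relation.Unary.Unique.Propositional using (Unique)
open import Data.Product using (Σ; _×_; ∃; ∃-syntax; _,_)
open import Data.Sum using (_⊎_)
open import Relation.Binary.PropositionalEquality using (_≡_; _≢_)
open import Relation.Nullary using (¬_)
open import Function.Definitions using (Injective)

record Graph (n : ℕ) : Set₁ where
  field
    Adj   : Fin n → Fin n → Set
    sym   : ∀ {u v} → Adj u v → Adj v u
    irref : ∀ {u} → ¬ Adj u u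
open Graph public

data Walk {m : ℕ} (A : Fin m → Fin m → Set) (P : Subset m) : Fin m → Fin m → ℕ → Set where
  here : ∀ {x} → x ∈ P → Walk A P x x 0
  step : ∀ {x y z k} → x ∈ P → A x y → Walk A P y z k → Walk A P x z (suc k)

DistLe : ∀ {m} → (Fin m → Fin m → Set) → Subset m → Fin m → Fin m → ℕ → Set
DistLe A P x y k = Σ ℕ λ j → j ≤ k × Walk A P x y j

-- a cycle: distinct nodes x ∷ ys (at least 3 of them), consecutive ones adjacent,
-- and the last one adjacent to x
HasCycle : ∀ {m} → (Fin m → Fin m → Set) → Set
HasCycle {m} A = Σ (Fin m) λ x → Σ (List (Fin m)) λ ys →
  (2 ≤ length ys) × Unique (x ∷ ys) × Linked A ((x ∷ ys) ∷ʳ x)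

record Tree (m : ℕ) : Set₁ where
  field
    Adj       : Fin m → Fin m → Set
    sym       : ∀ {u v} → Adj u v → Adj v u
    irref     : ∀ {u} → ¬ Adj u u
    connected : ∀ x y → ∃[ k ] Walk Adj ⊤ x y k
    acyclic   : ¬ HasCycle Adj
open Tree public

DistT≤ : ∀ {m} → Tree m → Fin m → Fin m → ℕ → Set
DistT≤ T x y k = DistLe (Adj T) ⊤ x y k

-- 4-Steiner roots: V(G) = Fin n is embedded in V(T) = Fin m via ι

record IsSteinerRoot4 {n m} (G : Graph n) (T : Tree m) (ι : Fin n → Fin m) : Set where
  field
    inj  : Injective _≡_ _≡_ ι
    edge : ∀ u v → u ≢ v → (Adj G u v → DistT≤ T (ι u) (ι v) 4)
                          × (DistT≤ T (ι u) (ι v) 4 → Adj G u v)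

IsSubtree : ∀ {m} → Tree m → Subset m → Set
IsSubtree T P = ∀ x y → x ∈ P → y ∈ P → ∃[ k ] Walk (Adj T) P x y k

-- P is (the node set of) T⟨X⟩: the smallest subtree of T containing ι(X)
IsSpan : ∀ {n m} → Tree m → (Fin n → Fin m) → Subset n → Subset m → Set
IsSpan {n} {m} T ι X P =
  IsSubtree T P × (∀ v → v ∈ X → ι v ∈ P) ×
  (∀ (Q : Subset m) → IsSubtree T Q → (∀ v → v ∈ X → ι v ∈ Q) → P ⊆ Q)

EccLe : ∀ {m} → Tree m → Subset m → Fin m → ℕ → Set
EccLe T P c k = ∀ w → w ∈ P → DistLe (Adj T) P c w k

InCenter : ∀ {m} → Tree m → Subset m → Fin m → Set
InCenter T P c = c ∈ P × (∀ c' → c' ∈ P → ∀ k → EccLe T P c' k → EccLe T P c k)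

-- the subtree P is a non-edge star: diameter exactly 2
IsNonEdgeStar : ∀ {m} → Tree m → Subset m → Set
IsNonEdgeStar {m} T P =
  (∀ x y → x ∈ P → y ∈ P → DistLe (Adj T) P x y 2) ×
  Σ (Fin m) λ x → Σ (Fin m) λ y → x ∈ P × y ∈ P × ¬ DistLe (Adj T) P x y 1

InClosedNbhd : ∀ {m} → Tree m → Fin m → Fin m → Set
InClosedNbhd T c w = w ≡ c ⊎ Adj T c w

IsClique : ∀ {n} → Graph n → Subset n → Set
IsClique G K = ∀ u v → u ∈ K → v ∈ K → u ≢ v → Adj G u v

IsMaximalClique : ∀ {n} → Graph n → Subset n → Set
IsMaximalClique {n} G K = IsClique G K × (∀ (K' : Subset n) → IsClique G K' → K ⊆ K' → K' ⊆ K)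

IsCliqueIntersection : ∀ {n} → Graph n → Subset n → Set
IsCliqueIntersection {n} G X =
  Nonempty X × Σ (List (Subset n)) λ Ks → Ks ≢ [] × All (IsMaximalClique G) Ks × X ≡ ⋂ Ks

Separates : ∀ {n} → Graph n → Subset n → Fin n → Fin n → Set
Separates G S a b = a ∉ S × b ∉ S × (∀ k → ¬ Walk (Adj G) (∁ S) a b k)

IsMinimalSeparator : ∀ {n} → Graph n → Subset n → Set
IsMinimalSeparator {n} G S = Σ (Fin n) λ a → Σ (Fin n) λ b →
  Separates G S a b × (∀ (S' : Subset n) → S' ⊂ S → ¬ Separates G S' a b)

-- We take c to be the hub of the star T⟨S⟩.  The proof rests on the tree
-- metric: paths in a tree are unique (a non-backtracking walk that repeats a
-- node yields a cycle), so `dist` is realised inside every subtree, and for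
-- each node c the first step `towards c u` names the branch at c holding u;
-- nodes in different branches have distances to c that add up.
--  * The leaves of T⟨S⟩ are real (removing one leaves a subtree), so the hub
--    c has two distinct real neighbours ι sˡ, ι sʳ with sˡ, sʳ ∈ S.
--  * Every vertex of the clique X is within 4 of both, hence within 3 of c;
--    so T⟨X⟩ lies in the ball of radius 3 around c, which forces every node
--    of minimum eccentricity of T⟨X⟩ (a center) into N_T[c].
--  * N_T[c] ⊇ T⟨S⟩ gives S ⊆ Real(N_T[c]).  Conversely a vertex v ∉ S with
--    ι v ∈ N_T[c] would be reached from both sides of S: by minimality each
--    side touches neighbours of sˡ and of sʳ, and walks avoiding S that stay
--    farther than 3 from c cannot switch branch, so each side comes within 3
--    of c and is then adjacent to v.
module Submission where

open import Defs hiding (sym)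

open import Data.Bool using (true)
open import Data.Empty using (⊥; ⊥-elim)
open import Data.Fin using (Fin; _≟_)
open import Data.Fin.Properties using () renaming (any? to anyFin?)
open import Data.Fin.Subset using (Subset; _∈_; _∉_; _⊆_; _⊂_; _-_; ⊤; ∁; ⋂)
open import Data.Fin.Subset.Properties
  using (∈⊤; _∈?_; x∈p∧x≢y⇒x∈p-y; x∈p⇒p-x⊂p; p─q⊆p; p∩q⊆p; x∈∁p⇒x∉p; x∉p⇒x∈∁p)
open import Data.List using (List; []; _∷_; length; _++_; _∷ʳ_; map; filter; allFin)
open import Data.List.Extrema.Nat using (max; argmin; xs≤max; max≤v⁺; f[argmin]≤f[xs]; argmin-all)
open import Data.List.Membership.Propositional using () renaming (_∈_ to _∈ˡ_)
open import Data.List.Membership.Propositional.Properties using (∈-allFin; ∈-filter⁺; ∈-filter⁻; ∈-map⁺)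
open import Data.List.Properties using (++-assoc)
open import Data.List.Relation.Unary.All as All using (All; []; _∷_; lookup)
open import Data.List.Relation.Unary.All.Properties using (map⁺)
open import Data.List.Relation.Unary.All.Properties.Core using (¬Any⇒All¬)
open import Data.List.Relation.Unary.AllPairs using ([]; _∷_)
open import Data.List.Relation.Unary.Any using (here; there; any?)
open import Data.List.Relation.Unary.Linked using (Linked; []; [-]; _∷_)
open import Data.List.Relation.Unary.Unique.Propositional using (Unique)
open import Data.Nat using (ℕ; zero; suc; _≤_; z≤n; s≤s; _+_; _≤?_)
open import Data.Nat.Properties hiding (_≟_)
open import Data.Product using (Σ; _×_; _,_; proj₁; proj₂)
open import Data.Sum using (_⊎_; inj₁; inj₂)
open import Data.Unit using (tt) renaming (⊤ to Unit)
open import Data.Vec using (tabulate)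
open import Data.Vec.Properties using (lookup∘tabulate; lookup⇒[]=; []=⇒lookup)
open import Function using (_∘_)
open import Relation.Binary.PropositionalEquality
open import Relation.Nullary using (¬_; Dec; yes; no; does)
open import Relation.Nullary.Decidable using (dec-true; _×-dec_; from-no)

module Walks {m : ℕ} (A : Fin m → Fin m → Set) (symA : ∀ {u v} → A u v → A v u) where

  walk-start∈ : ∀ {P x y k} → Walk A P x y k → x ∈ P
  walk-start∈ (here p)     = p
  walk-start∈ (step p _ _) = p

  walk-end∈ : ∀ {P x y k} → Walk A P x y k → y ∈ P
  walk-end∈ (here p)     = p
  walk-end∈ (step _ _ w) = walk-end∈ w

  infixr 5 _++ʷ_
  _++ʷ_ : ∀ {P x y z k j} → Walk A P x y k → Walk A P y z j → Walk A P x z (k + j)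
  here _     ++ʷ w′ = w′
  step p a w ++ʷ w′ = step p a (w ++ʷ w′)

  reverseʷ : ∀ {P x y k} → Walk A P x y k → Walk A P y x k
  reverseʷ (here p) = here p
  reverseʷ {P} (step {k = k} p a w) =
    subst (Walk A P _ _) (+-comm k 1) (reverseʷ w ++ʷ step (walk-start∈ w) (symA a) (here p))

  snocʷ : ∀ {P x y z k} → Walk A P x y k → A y z → z ∈ P → Walk A P x z (suc k)
  snocʷ {k = k} w a z∈P = subst (Walk A _ _ _) (+-comm k 1) (w ++ʷ step (walk-end∈ w) a (here z∈P))

data NonBacktracking {m : ℕ} : List (Fin m) → Set where
  nb-[]  : NonBacktracking []
  nb-[-] : ∀ {a} → NonBacktracking (a ∷ [])
  nb-2   : ∀ {a b} → NonBacktracking (a ∷ b ∷ [])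
  nb-∷   : ∀ {a b c l} → a ≢ c → NonBacktracking (b ∷ c ∷ l) → NonBacktracking (a ∷ b ∷ c ∷ l)

nb-tail : ∀ {m} {a : Fin m} {l} → NonBacktracking (a ∷ l) → NonBacktracking l
nb-tail nb-[-]     = nb-[]
nb-tail nb-2       = nb-[-]
nb-tail (nb-∷ _ n) = n

linked-tail : ∀ {m} {R : Fin m → Fin m → Set} {a l} → Linked R (a ∷ l) → Linked R l
linked-tail [-]     = []
linked-tail (_ ∷ l) = l

linked-prefix : ∀ {m} {R : Fin m → Fin m → Set} xs ys → Linked R (xs ++ ys) → Linked R xs
linked-prefix []           ys _       = []
linked-prefix (x ∷ [])     ys _       = [-]
linked-prefix (x ∷ y ∷ xs) ys (r ∷ l) = r ∷ linked-prefix (y ∷ xs) ys l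

all-prefix : ∀ {m} {P : Fin m → Set} xs ys → All P (xs ++ ys) → All P xs
all-prefix []       ys _       = []
all-prefix (x ∷ xs) ys (p ∷ a) = p ∷ all-prefix xs ys a

unique-prefix : ∀ {m} (xs ys : List (Fin m)) → Unique (xs ++ ys) → Unique xs
unique-prefix []       ys _       = []
unique-prefix (x ∷ xs) ys (p ∷ u) = all-prefix xs ys p ∷ unique-prefix xs ys u

lastFrom : ∀ {m} → Fin m → List (Fin m) → Fin m
lastFrom x []       = x
lastFrom x (v ∷ vs) = lastFrom v vs

secondFrom : ∀ {m} → Fin m → List (Fin m) → Fin m
secondFrom x []      = x
secondFrom x (v ∷ _) = v

lastFrom∈ : ∀ {m} (h v : Fin m) t → lastFrom h (v ∷ t) ∈ˡ (v ∷ t)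
lastFrom∈ h v []      = here refl
lastFrom∈ h v (w ∷ t) = there (lastFrom∈ v w t)

unique-not-closed : ∀ {m} (h v : Fin m) t → Unique (h ∷ v ∷ t) → lastFrom h (v ∷ t) ≢ h
unique-not-closed h v t (h∉ ∷ _) e = lookup h∉ (lastFrom∈ h v t) (sym e)

split-first : ∀ {m} (a : Fin m) l → a ∈ˡ l →
  Σ (List (Fin m)) λ pre → Σ (List (Fin m)) λ post → l ≡ pre ++ a ∷ post × ¬ (a ∈ˡ pre)
split-first a (b ∷ l) a∈ with a ≟ b
... | yes refl = [] , l , refl , λ ()
... | no a≢b with a∈
...   | here e    = ⊥-elim (a≢b e)
...   | there a∈l with split-first a l a∈l
...     | pre , post , eq , a∉ = b ∷ pre , post , cong (b ∷_) eq , λ { (here e) → a≢b e ; (there q) → a∉ q }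

revOnto : ∀ {m} → List (Fin m) → List (Fin m) → List (Fin m)
revOnto []       acc = acc
revOnto (v ∷ vs) acc = revOnto vs (v ∷ acc)

revOnto-shape : ∀ {m} (v : Fin m) vs acc → Σ (List (Fin m)) λ t →
  revOnto vs (v ∷ acc) ≡ lastFrom v vs ∷ t × lastFrom (lastFrom v vs) t ≡ lastFrom v acc
  × length t ≡ length vs + length acc
revOnto-shape v []        acc = acc , refl , refl , refl
revOnto-shape v (v′ ∷ vs) acc with revOnto-shape v′ vs (v ∷ acc)
... | t , e₁ , e₂ , e₃ = t , e₁ , e₂ , trans e₃ (+-suc _ _)

Fork : ∀ {m} → List (Fin m) → List (Fin m) → Set
Fork (u ∷ _) (w ∷ _) = u ≢ w
Fork _       _       = Unit

revOnto-nb : ∀ {m} (y : Fin m) xs acc → NonBacktracking (y ∷ xs) → NonBacktracking (y ∷ acc) →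
  Fork xs acc → NonBacktracking (revOnto xs (y ∷ acc))
revOnto-nb y []       acc _  nb₂ _ = nb₂
revOnto-nb y (z ∷ xs) acc nb₁ nb₂ fork =
  revOnto-nb z xs (y ∷ acc) (nb-tail nb₁) (extend acc nb₂ fork) (newFork xs nb₁)
  where
    extend : ∀ acc → NonBacktracking (y ∷ acc) → Fork (z ∷ xs) acc → NonBacktracking (z ∷ y ∷ acc)
    extend []      _  _    = nb-2
    extend (_ ∷ _) nb fork = nb-∷ fork nb
    newFork : ∀ xs → NonBacktracking (y ∷ z ∷ xs) → Fork xs (y ∷ acc)
    newFork []      _            = tt
    newFork (_ ∷ _) (nb-∷ ne _) = λ e → ne (sym e)

select : ∀ {m} {Q : Fin m → Set} → (∀ i → Dec (Q i)) → Subset m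
select Q? = tabulate (λ i → does (Q? i))

select⁺ : ∀ {m} {Q : Fin m → Set} (Q? : ∀ i → Dec (Q i)) {i} → Q i → i ∈ select Q?
select⁺ Q? {i} q = lookup⇒[]= i _ (trans (lookup∘tabulate _ i) (dec-true (Q? i) q))

select⁻ : ∀ {m} {Q : Fin m → Set} (Q? : ∀ i → Dec (Q i)) {i} → i ∈ select Q? → Q i
select⁻ Q? {i} i∈ = witness (Q? i) (trans (sym (lookup∘tabulate _ i)) ([]=⇒lookup i∈))
  where
    witness : ∀ {R : Set} (r? : Dec R) → does r? ≡ true → R
    witness (yes r) _ = r
    witness (no _)  ()

span-mono : ∀ {n m} {T : Tree m} {ι : Fin n → Fin m} {S X PS PX} →
  IsSpan T ι S PS → IsSpan T ι X PX → S ⊆ X → PS ⊆ PX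
span-mono (_ , _ , least) (sub , X⊆PX , _) S⊆X = least _ sub (λ v v∈ → X⊆PX v (S⊆X v∈))

members : ∀ {m} → Subset m → List (Fin m)
members {m} P = filter (_∈? P) (allFin m)

members⁺ : ∀ {m} {P : Subset m} {i} → i ∈ P → i ∈ˡ members P
members⁺ {P = P} {i} i∈ = ∈-filter⁺ (_∈? P) (∈-allFin i) i∈

members⁻ : ∀ {m} (P : Subset m) {i} → i ∈ˡ members P → i ∈ P
members⁻ {m} P i∈ = proj₂ (∈-filter⁻ (_∈? P) {xs = allFin m} i∈)

module TreeMetric {m : ℕ} (T : Tree m) where
  A : Fin m → Fin m → Set
  A = Adj T
  open Walks A (Tree.sym T) public

  revOnto-linked : ∀ y xs acc → Linked A (y ∷ xs) → Linked A (y ∷ acc) → Linked A (revOnto xs (y ∷ acc))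
  revOnto-linked y []       acc _        l₂ = l₂
  revOnto-linked y (z ∷ xs) acc (a ∷ l₁) l₂ = revOnto-linked z xs (y ∷ acc) l₁ (Tree.sym T a ∷ l₂)

  -- A non-backtracking walk in a tree never repeats a node: the part
  -- between two occurrences would be a cycle.
  nb-unique : ∀ l → Linked A l → NonBacktracking l → Unique l
  nb-unique []       _  _  = []
  nb-unique (a ∷ rest) lk nb = fresh (any? (a ≟_) rest) ∷ uniqueRest
    where
      uniqueRest : Unique rest
      uniqueRest = nb-unique rest (linked-tail lk) (nb-tail nb)
      noReturn : a ∈ˡ rest → ⊥
      noReturn a∈ with split-first a rest a∈
      ... | pre , post , refl , a∉ =
        acyclic T (a , pre , long pre lk nb , (¬Any⇒All¬ pre a∉ ∷ unique-prefix pre (a ∷ post) uniqueRest) , cycle)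
        where
          long : ∀ pre → Linked A (a ∷ pre ++ a ∷ post) → NonBacktracking (a ∷ pre ++ a ∷ post) → 2 ≤ length pre
          long []                (r ∷ _) _            = ⊥-elim (irref T r)
          long (b ∷ [])          _       (nb-∷ ne _) = ⊥-elim (ne refl)
          long (b ∷ b′ ∷ pre′)   _       _            = s≤s (s≤s z≤n)
          cycle : Linked A ((a ∷ pre) ∷ʳ a)
          cycle = linked-prefix ((a ∷ pre) ∷ʳ a) post
                    (subst (Linked A) (cong (a ∷_) (sym (++-assoc pre (a ∷ []) post))) lk)
      fresh : Dec (a ∈ˡ rest) → All (a ≢_) rest
      fresh (yes a∈) = ⊥-elim (noReturn a∈)
      fresh (no a∉)  = ¬Any⇒All¬ rest a∉

  nb-not-closed : ∀ x b ws → Linked A (x ∷ b ∷ ws) → NonBacktracking (x ∷ b ∷ ws) → lastFrom x (b ∷ ws) ≢ x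
  nb-not-closed x b ws lk nb = unique-not-closed x b ws (nb-unique _ lk nb)

  -- Two non-backtracking walks from x with the same end are equal: at the
  -- first fork, reversing one and appending the other gives a closed one.
  nb-walk-unique : ∀ x vs ws → Linked A (x ∷ vs) → NonBacktracking (x ∷ vs) →
    Linked A (x ∷ ws) → NonBacktracking (x ∷ ws) → lastFrom x vs ≡ lastFrom x ws → vs ≡ ws
  nb-walk-unique x []       []       _  _  _  _  _ = refl
  nb-walk-unique x []       (b ∷ ws) _  _  l₂ n₂ e = ⊥-elim (nb-not-closed x b ws l₂ n₂ (sym e))
  nb-walk-unique x (a ∷ vs) []       l₁ n₁ _  _  e = ⊥-elim (nb-not-closed x a vs l₁ n₁ e)
  nb-walk-unique x (a ∷ vs) (b ∷ ws) l₁ n₁ l₂ n₂ e with a ≟ b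
  ... | yes refl = cong (a ∷_) (nb-walk-unique a vs ws (linked-tail l₁) (nb-tail n₁) (linked-tail l₂) (nb-tail n₂) e)
  ... | no a≢b with revOnto-shape x (a ∷ vs) (b ∷ ws)
  ...   | []    , _  , _  , ()
  ...   | v ∷ t , e₁ , e₂ , _ =
    ⊥-elim (unique-not-closed (lastFrom a vs) v t
      (subst Unique e₁ (nb-unique _ (revOnto-linked x (a ∷ vs) (b ∷ ws) l₁ l₂) (revOnto-nb x (a ∷ vs) (b ∷ ws) n₁ n₂ a≢b)))
      (trans e₂ (sym e)))

  -- a path from x to y inside P, as the list of nodes after x
  record Path (P : Subset m) (x y : Fin m) : Set where
    constructor path
    field
      nodes  : List (Fin m)
      linked : Linked A (x ∷ nodes)
      nb     : NonBacktracking (x ∷ nodes)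
      ends   : lastFrom x nodes ≡ y
      inside : All (_∈ P) (x ∷ nodes)
  open Path public

  path-unique : ∀ {P Q x y} (p : Path P x y) (q : Path Q x y) → nodes p ≡ nodes q
  path-unique {x = x} p q = nb-walk-unique x (nodes p) (nodes q) (linked p) (nb p) (linked q) (nb q) (trans (ends p) (sym (ends q)))

  reduce : ∀ {P x y k} → Walk A P x y k → Σ (Path P x y) (λ p → length (nodes p) ≤ k)
  reduce (here p) = path [] [-] nb-[-] refl (p ∷ []) , z≤n
  reduce {x = x} (step {y = y} p a w) with reduce w
  ... | path [] lk nb en al , _ = path (y ∷ []) (a ∷ [-]) nb-2 en (p ∷ al) , s≤s z≤n
  ... | path (v ∷ vs) (b ∷ lk) nb en al , le with v ≟ x
  ...   | yes refl = path vs lk (nb-tail nb) en (All.tail al) , ≤-trans (n≤1+n _) (m≤n⇒m≤1+n le)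
  ...   | no v≢x   = path (y ∷ v ∷ vs) (a ∷ b ∷ lk) (nb-∷ (λ e → v≢x (sym e)) nb) en (p ∷ al) , s≤s le

  path-walk : ∀ {P x y} (p : Path P x y) → Walk A P x y (length (nodes p))
  path-walk (path vs lk _ refl al) = toWalk vs lk al
    where
      toWalk : ∀ {x} vs → Linked A (x ∷ vs) → All (_∈ _) (x ∷ vs) → Walk A _ x (lastFrom x vs) (length vs)
      toWalk []       _        (p ∷ []) = here p
      toWalk (v ∷ vs) (a ∷ lk) (p ∷ al) = step p a (toWalk vs lk al)

  treePath : ∀ x y → Path ⊤ x y
  treePath x y = proj₁ (reduce (proj₂ (connected T x y)))

  dist : Fin m → Fin m → ℕ
  dist x y = length (nodes (treePath x y))

  dist-path : ∀ {P x y} (p : Path P x y) → dist x y ≡ length (nodes p)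
  dist-path {x = x} {y} p = cong length (path-unique (treePath x y) p)

  walk⇒dist≤ : ∀ {P x y k} → Walk A P x y k → dist x y ≤ k
  walk⇒dist≤ w = subst (_≤ _) (sym (dist-path (proj₁ (reduce w)))) (proj₂ (reduce w))

  -- the tree path lies inside every vertex set that connects its ends
  dist≤⇒DistLe : ∀ {P x y j k} → Walk A P x y j → dist x y ≤ k → DistLe A P x y k
  dist≤⇒DistLe w le = let p = proj₁ (reduce w) in length (nodes p) , subst (_≤ _) (dist-path p) le , path-walk p

  DistLe⇒dist≤ : ∀ {P x y k} → DistLe A P x y k → dist x y ≤ k
  DistLe⇒dist≤ (_ , le , w) = ≤-trans (walk⇒dist≤ w) le

  geodesic : ∀ x y → Walk A ⊤ x y (dist x y)
  geodesic x y = path-walk (treePath x y)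

  dist-sym : ∀ x y → dist y x ≤ dist x y
  dist-sym x y = walk⇒dist≤ (reverseʷ (geodesic x y))

  dist-triangle : ∀ x y z → dist x z ≤ dist x y + dist y z
  dist-triangle x y z = walk⇒dist≤ (geodesic x y ++ʷ geodesic y z)

  dist-self : ∀ x → dist x x ≤ 0
  dist-self x = walk⇒dist≤ (here {A = A} {P = ⊤} ∈⊤)

  adj⇒dist≤1 : ∀ {x y} → A x y → dist x y ≤ 1
  adj⇒dist≤1 a = walk⇒dist≤ (step ∈⊤ a (here ∈⊤))

  dist≤0⇒≡ : ∀ {x y} → dist x y ≤ 0 → x ≡ y
  dist≤0⇒≡ {x} {y} le with dist≤⇒DistLe (geodesic x y) le
  ... | zero , _ , here _ = refl

  dist≤1⇒adj : ∀ {x y} → x ≢ y → dist x y ≤ 1 → A x y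
  dist≤1⇒adj {x} {y} x≢y le with dist≤⇒DistLe (geodesic x y) le
  ... | zero , _ , here _ = ⊥-elim (x≢y refl)
  ... | suc zero , _ , step _ a (here _) = a
  ... | suc (suc _) , s≤s () , _

  ≢⇒1≤dist : ∀ {x y} → x ≢ y → 1 ≤ dist x y
  ≢⇒1≤dist {x} {y} x≢y with dist x y in eq
  ... | zero  = ⊥-elim (x≢y (dist≤0⇒≡ (≤-reflexive eq)))
  ... | suc _ = s≤s z≤n

  -- towards c u: the first node after c on the tree path from c to u
  -- (c itself when u = c); it names the branch at c that contains u.
  towards : Fin m → Fin m → Fin m
  towards c u = secondFrom c (nodes (treePath c u))

  towards-neighbour : ∀ {c x} → A c x → towards c x ≡ x
  towards-neighbour {c} {x} a =
    cong (secondFrom c) (path-unique (treePath c x) (path (x ∷ []) (a ∷ [-]) nb-2 refl (∈⊤ ∷ ∈⊤ ∷ [])))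

  towards-adj : ∀ {c z} → z ≢ c → A c (towards c z)
  towards-adj {c} {z} z≢c = first (treePath c z) z≢c
    where
      first : (p : Path ⊤ c z) → z ≢ c → A c (secondFrom c (nodes p))
      first (path []      _       _ refl _) z≢c = ⊥-elim (z≢c refl)
      first (path (_ ∷ _) (a ∷ _) _ _    _) _   = a

  towards-closer : ∀ {c t q} → t ≢ c → towards c t ≡ q → suc (dist q t) ≤ dist c t
  towards-closer {c} {t} t≢c = closer (treePath c t) t≢c
    where
      closer : ∀ {q} (p : Path ⊤ c t) → t ≢ c → secondFrom c (nodes p) ≡ q → suc (dist q t) ≤ length (nodes p)
      closer (path []      _        _  refl _)        t≢c _    = ⊥-elim (t≢c refl)
      closer (path (q ∷ r) (_ ∷ lk) nb en   (_ ∷ al)) _   refl = s≤s (≤-reflexive (dist-path (path r lk (nb-tail nb) en al)))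

  towards∈ : ∀ {P c z j} → Walk A P c z j → towards c z ∈ P
  towards∈ {P} {c} {z} w =
    subst (_∈ P) (cong (secondFrom c) (path-unique (proj₁ (reduce w)) (treePath c z))) (second∈ (proj₁ (reduce w)))
    where
      second∈ : ∀ {z} (p : Path P c z) → secondFrom c (nodes p) ∈ P
      second∈ (path []      _ _ _ (p ∷ _))     = p
      second∈ (path (_ ∷ _) _ _ _ (_ ∷ q ∷ _)) = q

  -- Nodes in different branches at c are joined through c, so their
  -- distances to c add up.
  branch-sum : ∀ {c u w} → u ≢ c → w ≢ c → towards c u ≢ towards c w → dist u c + dist c w ≤ dist u w
  branch-sum {c} {u} {w} u≢c w≢c fork =
    ≤-trans (+-monoˡ-≤ (dist c w) (dist-sym c u)) (joined (treePath c u) (treePath c w) u≢c w≢c fork)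
    where
      joined : ∀ {u w} (pu : Path ⊤ c u) (pw : Path ⊤ c w) → u ≢ c → w ≢ c →
        secondFrom c (nodes pu) ≢ secondFrom c (nodes pw) → length (nodes pu) + length (nodes pw) ≤ dist u w
      joined (path []       _  _  refl _) _                            u≢c _   _ = ⊥-elim (u≢c refl)
      joined (path (_ ∷ _)  _  _  _    _) (path []      _ _ refl _)    _   w≢c _ = ⊥-elim (w≢c refl)
      joined (path (a ∷ vu) l₁ n₁ refl _) (path (b ∷ vw) l₂ n₂ refl _) _   _   a≢b
        with revOnto-shape c (a ∷ vu) (b ∷ vw)
      ... | t , e₁ , e₂ , e₃ = ≤-reflexive (sym (trans (dist-path uw) e₃))
        where
          uw : Path ⊤ (lastFrom a vu) (lastFrom b vw)
          uw = path t (subst (Linked A) e₁ (revOnto-linked c (a ∷ vu) (b ∷ vw) l₁ l₂))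
                      (subst NonBacktracking e₁ (revOnto-nb c (a ∷ vu) (b ∷ vw) n₁ n₂ a≢b)) e₂ (All.universal (λ _ → ∈⊤) _)

  adj⇒≢ : ∀ {u w} → A u w → w ≢ u
  adj⇒≢ a refl = irref T a

  far⇒≢ : ∀ {c u r} → ¬ dist c u ≤ r → u ≢ c
  far⇒≢ {c} far refl = far (≤-trans (dist-self c) z≤n)

  beyond-neighbour : ∀ {c u x} → A c x → u ≢ c → towards c u ≢ x → suc (dist u c) ≤ dist u x
  beyond-neighbour {c} {u} {x} a u≢c away = begin
    suc (dist u c)        ≡⟨ +-comm 1 (dist u c) ⟩
    dist u c + 1          ≤⟨ +-monoʳ-≤ (dist u c) (≢⇒1≤dist (λ e → adj⇒≢ a (sym e))) ⟩
    dist u c + dist c x   ≤⟨ branch-sum u≢c (adj⇒≢ a) (λ e → away (trans e (towards-neighbour a))) ⟩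
    dist u x              ∎
    where open ≤-Reasoning

  nbhd⇒dist≤1 : ∀ {c w} → InClosedNbhd T c w → dist c w ≤ 1
  nbhd⇒dist≤1 {c} (inj₁ refl) = ≤-trans (dist-self c) z≤n
  nbhd⇒dist≤1     (inj₂ a)    = adj⇒dist≤1 a

  dist≤1⇒nbhd : ∀ {c w} → dist c w ≤ 1 → InClosedNbhd T c w
  dist≤1⇒nbhd {c} {w} le with w ≟ c
  ... | yes w≡c = inj₁ w≡c
  ... | no  w≢c = inj₂ (dist≤1⇒adj (λ e → w≢c (sym e)) le)

  ball : Fin m → ℕ → Subset m
  ball c r = select (λ w → dist c w ≤? r)

  ∈ball⁺ : ∀ {c r w} → dist c w ≤ r → w ∈ ball c r
  ∈ball⁺ {c} {r} = select⁺ (λ w → dist c w ≤? r)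

  ∈ball⁻ : ∀ {c r w} → w ∈ ball c r → dist c w ≤ r
  ∈ball⁻ {c} {r} = select⁻ (λ w → dist c w ≤? r)

  walk-in-ball : ∀ {c r u w k} → Walk A ⊤ u w k → dist c u + k ≤ r → Walk A (ball c r) u w k
  walk-in-ball {c} {u = u} (here _) le = here (∈ball⁺ (≤-trans (m≤m+n (dist c u) 0) le))
  walk-in-ball {c} {u = u} (step {y = u′} {k = k} _ a w) le =
    step (∈ball⁺ (≤-trans (m≤m+n _ _) le)) a (walk-in-ball w (begin
      dist c u′ + k             ≤⟨ +-monoˡ-≤ k (dist-triangle c u u′) ⟩
      dist c u + dist u u′ + k  ≤⟨ +-monoˡ-≤ k (+-monoʳ-≤ (dist c u) (adj⇒dist≤1 a)) ⟩
      dist c u + 1 + k          ≡⟨ +-assoc (dist c u) 1 k ⟩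
      dist c u + suc k          ≤⟨ le ⟩
      _                         ∎))
    where open ≤-Reasoning

  ball-subtree : ∀ c r → IsSubtree T (ball c r)
  ball-subtree c r w₁ w₂ w₁∈ w₂∈ = _ , reverseʷ (fromCentre w₁∈) ++ʷ fromCentre w₂∈
    where
      fromCentre : ∀ {w} → w ∈ ball c r → Walk A (ball c r) c w (dist c w)
      fromCentre {w} w∈ = walk-in-ball (geodesic c w) (≤-trans (+-monoˡ-≤ (dist c w) (dist-self c)) (∈ball⁻ w∈))

  span-within : ∀ {n} {ι : Fin n → Fin m} {X P c r} → IsSpan T ι X P →
    (∀ v → v ∈ X → dist c (ι v) ≤ r) → ∀ t → t ∈ P → dist c t ≤ r
  span-within {c = c} {r} (_ , _ , least) X-within t t∈ =
    ∈ball⁻ (least (ball c r) (ball-subtree c r) (λ v v∈ → ∈ball⁺ (X-within v v∈)) t∈)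

  ecc : Subset m → Fin m → ℕ
  ecc P w = max 0 (map (dist w) (members P))

  ecc-ub : ∀ {P w t} → t ∈ P → dist w t ≤ ecc P w
  ecc-ub {P} {w} {t} t∈ = All.lookup (xs≤max 0 (map (dist w) (members P))) (∈-map⁺ (dist w) (members⁺ t∈))

  ecc-lub : ∀ {P w k} → (∀ t → t ∈ P → dist w t ≤ k) → ecc P w ≤ k
  ecc-lub {P} bound = max≤v⁺ z≤n (map⁺ (All.tabulate (λ t∈ → bound _ (members⁻ P t∈))))

  min-ecc-exists : ∀ {P c} → c ∈ P → Σ (Fin m) λ z → z ∈ P × (∀ w → w ∈ P → ecc P z ≤ ecc P w)
  min-ecc-exists {P} {c} c∈ =
    z , argmin-all (ecc P) c∈ (All.tabulate (members⁻ P)) ,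
    λ w w∈ → All.lookup (f[argmin]≤f[xs] c (members P)) (members⁺ w∈)
    where
      z : Fin m
      z = argmin (ecc P) c (members P)

  min-ecc⇒InCenter : ∀ {P z} → IsSubtree T P → z ∈ P → (∀ w → w ∈ P → ecc P z ≤ ecc P w) → InCenter T P z
  min-ecc⇒InCenter {P} {z} sub z∈ minimal = z∈ , λ c′ c′∈ k eccLe t t∈ →
    dist≤⇒DistLe (proj₂ (sub z t z∈ t∈))
      (≤-trans (ecc-ub t∈) (≤-trans (minimal c′ c′∈) (ecc-lub (λ t t∈ → DistLe⇒dist≤ (eccLe t t∈)))))

  -- A node at distance at most r+1 from two distinct neighbours of c is
  -- within distance r of c: it is outside the branch of one of them.
  between-neighbours : ∀ {c x y u r} → A c x → A c y → x ≢ y →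
    dist u x ≤ suc r → dist u y ≤ suc r → dist u c ≤ r
  between-neighbours {c} {x} {y} {u} a b x≢y ux uy with u ≟ c
  ... | yes refl = ≤-trans (dist-self u) z≤n
  ... | no u≢c with towards c u ≟ x
  ...   | no  away = ≤-pred (≤-trans (beyond-neighbour a u≢c away) ux)
  ...   | yes tx   = ≤-pred (≤-trans (beyond-neighbour b u≢c (λ ty → x≢y (trans (sym tx) ty))) uy)

  -- Two nodes at distance more than 3 from c and at most 4 from each other
  -- lie in the same branch at c (else they would be 8 apart).
  far-pair-same-branch : ∀ {c a b} → ¬ dist c a ≤ 3 → ¬ dist c b ≤ 3 → dist a b ≤ 4 → towards c a ≡ towards c b
  far-pair-same-branch {c} {a} {b} farA farB ab with towards c a ≟ towards c b
  ... | yes same = same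
  ... | no  fork = ⊥-elim (from-no (8 ≤? 4) (begin
        8                     ≤⟨ +-mono-≤ (≤-trans (≰⇒> farA) (dist-sym a c)) (≰⇒> farB) ⟩
        dist a c + dist c b   ≤⟨ branch-sum (far⇒≢ farA) (far⇒≢ farB) fork ⟩
        dist a b              ≤⟨ ab ⟩
        4                     ∎))
    where open ≤-Reasoning

  far-near-neighbour : ∀ {c a x} → A c x → ¬ dist c a ≤ 3 → dist a x ≤ 4 → towards c a ≡ x
  far-near-neighbour {c} {a} {x} cx far ax with towards c a ≟ x
  ... | yes tx   = tx
  ... | no  away = ⊥-elim (far (≤-trans (dist-sym a c) (≤-pred (≤-trans (beyond-neighbour cx (far⇒≢ far) away) ax))))

  -- Let P be a subtree within distance 3 of a node c that has two distinct
  -- neighbours in P.  A node z of P with minimum eccentricity is in N_T[c]: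
  -- if dist z c ≥ 2 then ecc z ≥ 3, yet the first node q from c towards z
  -- has ecc q ≤ 2 (nodes in other branches are within 1 of c, because
  -- they are within 3 of z).
  min-ecc-near-hub : ∀ {P c x y z} → IsSubtree T P → c ∈ P → x ∈ P → y ∈ P →
    A c x → A c y → x ≢ y → (∀ t → t ∈ P → dist c t ≤ 3) →
    z ∈ P → (∀ w → w ∈ P → ecc P z ≤ ecc P w) → dist z c ≤ 1
  min-ecc-near-hub {P} {c} {x} {y} {z} sub c∈ x∈ y∈ cx cy x≢y within3 z∈ minimal with dist z c ≤? 1
  ... | yes close = close
  ... | no  far   = ⊥-elim (1+n≰n (≤-trans ecc-z≥3 (≤-trans (minimal q q∈) (ecc-lub q-bound))))
    where
      2≤dist : 2 ≤ dist z c
      2≤dist = ≰⇒> far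
      z≢c : z ≢ c
      z≢c e = far⇒≢ far (sym e)
      q : Fin m
      q = towards c z
      q∈ : q ∈ P
      q∈ = towards∈ (proj₂ (sub c z c∈ z∈))
      ecc-z≤3 : ecc P z ≤ 3
      ecc-z≤3 = ≤-trans (minimal c c∈) (ecc-lub within3)
      ecc-z≥3 : 3 ≤ ecc P z
      ecc-z≥3 with q ≟ x
      ... | no  away = ≤-trans (s≤s 2≤dist) (≤-trans (beyond-neighbour cx z≢c away) (ecc-ub x∈))
      ... | yes qx   = ≤-trans (s≤s 2≤dist)
                         (≤-trans (beyond-neighbour cy z≢c (λ qy → x≢y (trans (sym qx) qy))) (ecc-ub y∈))
      q-bound : ∀ t → t ∈ P → dist q t ≤ 2
      q-bound t t∈ with t ≟ c
      ... | yes refl = ≤-trans (adj⇒dist≤1 (Tree.sym T (towards-adj z≢c))) (s≤s z≤n)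
      ... | no  t≢c with towards c t ≟ q
      ...   | yes same  = ≤-pred (≤-trans (towards-closer t≢c same) (within3 t t∈))
      ...   | no  apart with dist c t ≤? 1
      ...     | yes ct≤1 = ≤-trans (dist-triangle q c t) (+-mono-≤ (adj⇒dist≤1 (Tree.sym T (towards-adj z≢c))) ct≤1)
      ...     | no  ct≰1 = ⊥-elim (1+n≰n (begin
                  4                    ≤⟨ +-mono-≤ 2≤dist (≰⇒> ct≰1) ⟩
                  dist z c + dist c t  ≤⟨ branch-sum z≢c t≢c (λ e → apart (sym e)) ⟩
                  dist z t             ≤⟨ ecc-ub t∈ ⟩
                  ecc P z              ≤⟨ ecc-z≤3 ⟩
                  3                    ∎))
        where open ≤-Reasoning

  center-in-nbhd : ∀ {P c x y} → IsSubtree T P → c ∈ P → x ∈ P → y ∈ P →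
    A c x → A c y → x ≢ y → (∀ t → t ∈ P → dist c t ≤ 3) →
    Σ (Fin m) λ z → InCenter T P z × InClosedNbhd T z c
  center-in-nbhd sub c∈ x∈ y∈ cx cy x≢y within3 with min-ecc-exists c∈
  ... | z , z∈ , minimal =
    z , min-ecc⇒InCenter sub z∈ minimal , dist≤1⇒nbhd (min-ecc-near-hub sub c∈ x∈ y∈ cx cy x≢y within3 z∈ minimal)

module Stars {m : ℕ} (T : Tree m) where
  open TreeMetric T

  record Hub (P : Subset m) : Set where
    field
      hub           : Fin m
      hub∈          : hub ∈ P
      leafˡ leafʳ   : Fin m
      leafˡ∈        : leafˡ ∈ P
      leafʳ∈        : leafʳ ∈ P
      hub-leafˡ     : A hub leafˡ
      hub-leafʳ     : A hub leafʳ
      leaves-differ : leafˡ ≢ leafʳ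
      covers        : ∀ w → w ∈ P → InClosedNbhd T hub w

  -- the middle node of a diametral path of a non-edge star is its hub
  star-hub : ∀ {P} → IsNonEdgeStar T P → Hub P
  star-hub {P} (diam≤2 , x , y , x∈ , y∈ , far) with diam≤2 x y x∈ y∈
  ... | zero , _ , w = ⊥-elim (far (0 , z≤n , w))
  ... | suc zero , _ , w = ⊥-elim (far (1 , ≤-refl , w))
  ... | suc (suc (suc _)) , s≤s (s≤s ()) , _
  ... | suc (suc zero) , _ , step {y = c} _ xc (step c∈ cy (here _)) = record
    { hub = c ; hub∈ = c∈ ; leafˡ = x ; leafʳ = y ; leafˡ∈ = x∈ ; leafʳ∈ = y∈
    ; hub-leafˡ = Tree.sym T xc ; hub-leafʳ = cy ; leaves-differ = x≢y ; covers = covers }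
    where
      x≢y : x ≢ y
      x≢y refl = far (0 , z≤n , here x∈)
      covers : ∀ w → w ∈ P → InClosedNbhd T c w
      covers w w∈ with w ≟ c
      ... | yes w≡c = inj₁ w≡c
      ... | no  w≢c = inj₂ (dist≤1⇒adj (λ e → w≢c (sym e)) (≤-trans (dist-sym w c)
              (between-neighbours (Tree.sym T xc) cy x≢y (DistLe⇒dist≤ (diam≤2 w x w∈ x∈)) (DistLe⇒dist≤ (diam≤2 w y w∈ y∈)))))

  star-minus-subtree : ∀ {P} (H : Hub P) {z} → z ≢ Hub.hub H → IsSubtree T (P - z)
  star-minus-subtree {P} H {z} z≢c w₁ w₂ w₁∈ w₂∈ = _ , proj₂ (toHub w₁∈) ++ʷ reverseʷ (proj₂ (toHub w₂∈))
    where
      open Hub H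
      hub∈′ : hub ∈ P - z
      hub∈′ = x∈p∧x≢y⇒x∈p-y hub∈ (λ e → z≢c (sym e))
      toHub : ∀ {w} → w ∈ P - z → Σ ℕ λ k → Walk A (P - z) w hub k
      toHub {w} w∈ with covers w (p─q⊆p P _ w∈)
      ... | inj₁ refl = 0 , here w∈
      ... | inj₂ a    = 1 , step w∈ (Tree.sym T a) (here hub∈′)

  -- A node of the span T⟨X⟩ whose removal leaves a subtree is real:
  -- otherwise T⟨X⟩ without it would be a smaller subtree containing ι(X).
  span-removable⇒real : ∀ {n} {ι : Fin n → Fin m} {X P z} → IsSpan T ι X P → z ∈ P →
    IsSubtree T (P - z) → Σ (Fin n) λ v → v ∈ X × ι v ≡ z
  span-removable⇒real {ι = ι} {X} {P} {z} (_ , X⊆P , least) z∈ sub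
    with anyFin? (λ v → (v ∈? X) ×-dec (ι v ≟ z))
  ... | yes real = real
  ... | no  none with x∈p⇒p-x⊂p {p = P} z∈
  ...   | _ , _ , w∈ , w∉ = ⊥-elim (w∉ (P⊆P-z w∈))
    where
      P⊆P-z : P ⊆ P - z
      P⊆P-z = least (P - z) sub (λ v v∈ → x∈p∧x≢y⇒x∈p-y (X⊆P v v∈) (λ e → none (v , v∈ , e)))

  record RealNeighbours {n} (ι : Fin n → Fin m) (S : Subset n) (c : Fin m) : Set where
    field
      sˡ sʳ         : Fin n
      sˡ∈           : sˡ ∈ S
      sʳ∈           : sʳ ∈ S
      c-sˡ          : A c (ι sˡ)
      c-sʳ          : A c (ι sʳ)
      images-differ : ι sˡ ≢ ι sʳ

  -- if T⟨S⟩ is a non-edge star, its leaves are real, so its hub has two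
  -- distinct real neighbours
  span-hub-real-neighbours : ∀ {n} {ι : Fin n → Fin m} {S P} → IsSpan T ι S P → (H : Hub P) →
    RealNeighbours ι S (Hub.hub H)
  span-hub-real-neighbours spanS H
    with span-removable⇒real spanS (Hub.leafˡ∈ H) (star-minus-subtree H (adj⇒≢ (Hub.hub-leafˡ H)))
       | span-removable⇒real spanS (Hub.leafʳ∈ H) (star-minus-subtree H (adj⇒≢ (Hub.hub-leafʳ H)))
  ... | sˡ , sˡ∈ , eˡ | sʳ , sʳ∈ , eʳ = record
    { sˡ = sˡ ; sʳ = sʳ ; sˡ∈ = sˡ∈ ; sʳ∈ = sʳ∈
    ; c-sˡ = subst (A hub) (sym eˡ) hub-leafˡ ; c-sʳ = subst (A hub) (sym eʳ) hub-leafʳ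
    ; images-differ = λ e → leaves-differ (trans (sym eˡ) (trans e eʳ)) }
    where open Hub H

clique-intersection⇒clique : ∀ {n} {G : Graph n} {X} → IsCliqueIntersection G X → IsClique G X
clique-intersection⇒clique (_ , []     , nonempty , _          , _)    = ⊥-elim (nonempty refl)
clique-intersection⇒clique (_ , K ∷ Ks , _        , (K-max ∷ _) , refl) u v u∈ v∈ =
  proj₁ K-max u v (p∩q⊆p K (⋂ Ks) u∈) (p∩q⊆p K (⋂ Ks) v∈)

module SteinerRoot {n m : ℕ} (G : Graph n) (T : Tree m) (ι : Fin n → Fin m) (R : IsSteinerRoot4 G T ι) where
  open TreeMetric T
  open Stars T
  module GW = Walks (Adj G) (Graph.sym G)

  edge⇒dist≤4 : ∀ {u v} → u ≢ v → Adj G u v → dist (ι u) (ι v) ≤ 4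
  edge⇒dist≤4 {u} {v} u≢v e = DistLe⇒dist≤ (proj₁ (IsSteinerRoot4.edge R u v u≢v) e)

  dist≤4⇒edge : ∀ {u v} → u ≢ v → dist (ι u) (ι v) ≤ 4 → Adj G u v
  dist≤4⇒edge {u} {v} u≢v le = proj₂ (IsSteinerRoot4.edge R u v u≢v) (dist≤⇒DistLe (geodesic _ _) le)

  clique-dist≤4 : ∀ {X u w} → IsClique G X → u ∈ X → w ∈ X → dist (ι u) (ι w) ≤ 4
  clique-dist≤4 {X} {u} {w} K u∈ w∈ with u ≟ w
  ... | yes refl = ≤-trans (dist-self (ι u)) z≤n
  ... | no  u≢w  = edge⇒dist≤4 u≢w (K u w u∈ w∈ u≢w)

  clique-near-hub : ∀ {X S c} → IsClique G X → S ⊆ X → RealNeighbours ι S c → ∀ v → v ∈ X → dist c (ι v) ≤ 3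
  clique-near-hub {c = c} K S⊆X N v v∈ = ≤-trans (dist-sym (ι v) c)
    (between-neighbours c-sˡ c-sʳ images-differ (clique-dist≤4 K v∈ (S⊆X sˡ∈)) (clique-dist≤4 K v∈ (S⊆X sʳ∈)))
    where open RealNeighbours N

  module _ {S : Subset n} {c : Fin m} where

    NearReach : Fin n → Set
    NearReach u = Σ (Fin n) λ w → dist c (ι w) ≤ 3 × Σ ℕ λ k → Walk (Adj G) (∁ S) u w k

    Hit : Fin n → Fin n → Set
    Hit u s = Σ (Fin n) λ p → Σ ℕ λ k → Walk (Adj G) (∁ S) u p k × Adj G p s

    -- A walk avoiding S towards a neighbour of s ∈ S, where ι s is a tree
    -- neighbour of c, either comes within 3 of c, or starts in the branch
    -- of ι s: far vertices adjacent in G stay in one branch at c.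
    escape : ∀ {s} → A c (ι s) → s ∈ S → ∀ {u} → Hit u s → NearReach u ⊎ towards c (ι u) ≡ ι s
    escape {s} cs s∈ (_ , _ , W , ps) = along W ps
      where
        along : ∀ {u p k} → Walk (Adj G) (∁ S) u p k → Adj G p s → NearReach u ⊎ towards c (ι u) ≡ ι s
        along {u} W ps with dist c (ι u) ≤? 3
        ... | yes near = inj₁ (u , near , 0 , here (GW.walk-start∈ W))
        along {u} (here u∉) us | no far =
          inj₂ (far-near-neighbour cs far (edge⇒dist≤4 (λ { refl → x∈∁p⇒x∉p u∉ s∈ }) us))
        along {u} (step {y = u′} u∉ uu′ W) ps | no far with along W ps
        ... | inj₁ (w , near , k , W′) = inj₁ (w , near , suc k , step u∉ uu′ W′)
        ... | inj₂ branch with dist c (ι u′) ≤? 3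
        ...   | yes near′ = inj₁ (_ , near′ , 1 , step u∉ uu′ (here (GW.walk-start∈ W)))
        ...   | no  far′  = inj₂ (trans (far-pair-same-branch far far′
                              (edge⇒dist≤4 (λ { refl → Graph.irref G uu′ }) uu′)) branch)

    avoid-or-hit : ∀ {s u t k} → Walk (Adj G) (∁ (S - s)) u t k → u ∉ S →
      (Σ ℕ λ k′ → Walk (Adj G) (∁ S) u t k′) ⊎ Hit u s
    avoid-or-hit (here _) u∉ = inj₁ (0 , here (x∉p⇒x∈∁p u∉))
    avoid-or-hit {s} {u} (step {y = u′} _ uu′ W) u∉ with u′ ≟ s
    ... | yes refl = inj₂ (u , 0 , here (x∉p⇒x∈∁p u∉) , uu′)
    ... | no  u′≢s with avoid-or-hit W (λ u′∈ → x∈∁p⇒x∉p (GW.walk-start∈ W) (x∈p∧x≢y⇒x∈p-y u′∈ u′≢s))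
    ...   | inj₁ (k , W′)          = inj₁ (suc k , step (x∉p⇒x∈∁p u∉) uu′ W′)
    ...   | inj₂ (p , k , W′ , ps) = inj₂ (p , suc k , step (x∉p⇒x∈∁p u∉) uu′ W′ , ps)

    -- No vertex v ∉ S has its image in N_T[c]:
    -- by minimality each side of S reaches neighbours of sˡ and of sʳ, so
    -- (by escape) comes within 3 of c, hence is adjacent to v; then v would
    -- join the two sides.
    outside-far-from-hub : ∀ {v} → IsMinimalSeparator G S → RealNeighbours ι S c → v ∉ S → ¬ dist c (ι v) ≤ 1
    outside-far-from-hub {v} (a , b , (a∉ , b∉ , cut) , minimal) N v∉ cv≤1 =
      minimal (S - sˡ) (x∈p⇒p-x⊂p sˡ∈) (∉-minus a∉ , ∉-minus b∉ , λ _ Wˡ →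
      minimal (S - sʳ) (x∈p⇒p-x⊂p sʳ∈) (∉-minus a∉ , ∉-minus b∉ , λ _ Wʳ →
        cut _ (proj₂ (reach a∉ cut Wˡ Wʳ) GW.++ʷ
               GW.reverseʷ (proj₂ (reach b∉ (λ k → cut k ∘ GW.reverseʷ) (GW.reverseʷ Wˡ) (GW.reverseʷ Wʳ))))))
      where
        open RealNeighbours N
        ∉-minus : ∀ {u s} → u ∉ S → u ∉ S - s
        ∉-minus u∉ u∈ = u∉ (p─q⊆p S _ u∈)

        near⇒reach-v : ∀ {u} → NearReach u → Σ ℕ λ k → Walk (Adj G) (∁ S) u v k
        near⇒reach-v (w , cw≤3 , k , W) with w ≟ v
        ... | yes refl = k , W
        ... | no  w≢v  = suc k , GW.snocʷ W (dist≤4⇒edge w≢v wv≤4) (x∉p⇒x∈∁p v∉)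
          where
            wv≤4 : dist (ι w) (ι v) ≤ 4
            wv≤4 = ≤-trans (dist-triangle (ι w) c (ι v)) (+-mono-≤ (≤-trans (dist-sym c (ι w)) cw≤3) cv≤1)

        hit : ∀ {u t s k} → u ∉ S → (∀ k → ¬ Walk (Adj G) (∁ S) u t k) → Walk (Adj G) (∁ (S - s)) u t k → Hit u s
        hit u∉ separated W with avoid-or-hit W u∉
        ... | inj₁ (k , W′) = ⊥-elim (separated k W′)
        ... | inj₂ h        = h

        reach : ∀ {u t kˡ kʳ} → u ∉ S → (∀ k → ¬ Walk (Adj G) (∁ S) u t k) →
          Walk (Adj G) (∁ (S - sˡ)) u t kˡ → Walk (Adj G) (∁ (S - sʳ)) u t kʳ → Σ ℕ λ k → Walk (Adj G) (∁ S) u v k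
        reach u∉ separated Wˡ Wʳ with escape c-sˡ sˡ∈ (hit u∉ separated Wˡ) | escape c-sʳ sʳ∈ (hit u∉ separated Wʳ)
        ... | inj₁ near | _         = near⇒reach-v near
        ... | inj₂ _    | inj₁ near = near⇒reach-v near
        ... | inj₂ eˡ   | inj₂ eʳ   = ⊥-elim (images-differ (trans (sym eˡ) eʳ))

  hub-real-neighbourhood : ∀ {S P} → IsMinimalSeparator G S → IsSpan T ι S P → (H : Hub P) →
    RealNeighbours ι S (Hub.hub H) →
    ∀ v → (InClosedNbhd T (Hub.hub H) (ι v) → v ∈ S) × (v ∈ S → InClosedNbhd T (Hub.hub H) (ι v))
  hub-real-neighbourhood {S} MS spanS H N v = in-S , λ v∈ → Hub.covers H (ι v) (proj₁ (proj₂ spanS) v v∈)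
    where
      in-S : InClosedNbhd T (Hub.hub H) (ι v) → v ∈ S
      in-S near with v ∈? S
      ... | yes v∈ = v∈
      ... | no  v∉ = ⊥-elim (outside-far-from-hub MS N v∉ (nbhd⇒dist≤1 near))

lemma6p5 : ∀ {n m} (G : Graph n) (T : Tree m) (ι : Fin n → Fin m) →
    IsSteinerRoot4 G T ι →
    (X S : Subset n) → IsCliqueIntersection G X → S ⊂ X → IsMinimalSeparator G S →
    (TX TS : Subset m) → IsSpan T ι X TX → IsSpan T ι S TS →
    IsNonEdgeStar T TS →
    Σ (Fin m) λ c → (Σ (Fin m) λ z → InCenter T TX z × InClosedNbhd T z c) ×
    (∀ v → (InClosedNbhd T c (ι v) → v ∈ S) × (v ∈ S → InClosedNbhd T c (ι v)))
lemma6p5 G T ι R X S CI (S⊆X , _) MS TX TS spanX spanS star =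
  hub , center-in-nbhd (proj₁ spanX) (TS⊆TX (Hub.hub∈ H)) (X⊆TX (S⊆X sˡ∈)) (X⊆TX (S⊆X sʳ∈))
          c-sˡ c-sʳ images-differ TX-near ,
  hub-real-neighbourhood MS spanS H N
  where
    open TreeMetric T
    open Stars T
    open SteinerRoot G T ι R
    H : Hub TS
    H = star-hub star
    open Hub H using (hub)
    N : RealNeighbours ι S hub
    N = span-hub-real-neighbours spanS H
    open RealNeighbours N
    X⊆TX : ∀ {v} → v ∈ X → ι v ∈ TX
    X⊆TX {v} = proj₁ (proj₂ spanX) v
    TS⊆TX : TS ⊆ TX
    TS⊆TX = span-mono {T = T} {S = S} {X} spanS spanX S⊆X
    -- T⟨X⟩ lies within distance 3 of the hub, as ι(X) does
    TX-near : ∀ t → t ∈ TX → dist hub t ≤ 3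
    TX-near = span-within {c = hub} spanX (clique-near-hub (clique-intersection⇒clique {G = G} CI) S⊆X N)
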